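{- Let $(E,f,S)$ be a (possibly incoherent) partial Dowling geometry of rank $r$. Any two distinct elements $x,y\in E$ satisfy $f(x,y)=2$, unless $x=s_{i,j}$ and $y=s'_{i,j}$ for some $s,s'\in S$ and some distinct $1\le i,j\le r$.
   Context: A polymatroid is $(E,f)$ with $f:\mathcal{P}(E)\to\mathbb{R}$, $f(\emptyset)=0$, monotone, submodular (and of finite type, $f(S)=\sup_{F\subseteq S\text{ finite}}f(F)$, if $E$ is infinite); $f(a_1,\dots,a_k):=f(\{a_1,\dots,a_k\})$ and $\mathrm{cl}(A)=\{x\in E\mid f(A\cup\{x\})=f(A)\}$. A partial Dowling geometry (PDG) of rank $r$ is a triple $(E,f,S)$ where $(E,f)$ is a polymatroid and: (1) $S$ is a set with an involution $s\mapsto s^{ -1}$ and a distinguished element $e$ with $e^{ -1}=e$; (2) $E$ contains $B=\{b_1,\ldots,b_r\}$ with $f(A)=|A|$ for all $A\subseteq B$; (3) for each $1\le i<j\le r$, $E$ contains a copy $\{s_{i,j}\mid s\in S\}$ of $S$, these copies pairwise disjoint and disjoint from $B$, and $E=B\sqcup\bigsqcup_{i<j}\{s_{i,j}\mid s\in S\}$; one sets $s_{i,j}^{ -1}:=(s^{ -1})_{i,j}$, and for $i<j$, $s_{j,i}:=s_{i,j}^{ -1}$ and $s_{j,i}^{ -1}:=s_{i,j}$; (4) $s_{i,j}\in\mathrm{cl}(b_i,b_j)$ for all distinct $i,j$; (5) $f(s_{i,j})=1$ and $f(b_i,s_{i,j})=2$ for all $s\in S$ and distinct $i,j$; (6) $f(s_{i,j},s^{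 -1}_{j,k},e_{k,i})=2$ for all $s\in S$ and distinct $i,j,k$. An incoherent PDG is a triple satisfying all these except (3) and (6); instead of (3) one only requires $B\subseteq E\subseteq B\sqcup\bigsqcup_{i<j}\{s_{i,j}\mid s\in S\}$, with (4),(5) required only for those $s_{i,j}$ lying in $E$. "Possibly incoherent PDG" means a PDG or an incoherent PDG. -}

module Defs where

open import Level using (0ℓ)
open import Data.Nat using (ℕ; zero; suc)
open import Data.Fin using (Fin; _<_; _>_)
open import Data.Fin.Properties using (<-cmp)
open import Data.Fin.Subset using (Subset; _∈_; ∣_∣)
open import Data.List using (List; []; _∷_)
import Data.List.Membership.Propositional as L
open import Data.Product using (Σ; ∃; _×_; _,_)
open import Relation.Binary.PropositionalEquality using (_≡_; _≢_; refl)
open import Relation.Binary.Definitions using (tri<; tri≈; tri>)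
open import Relation.Binary.Structures using (IsTotalOrder)
open import Relation.Unary using (Pred; _⊆_; _∪_; _∩_; ∅)
open import Relation.Nullary using (¬_)
open import Data.Empty using (⊥-elim)
open import Algebra.Structures using (IsCommutativeRing)

-- Value domain of the rank function.  The paper uses ℝ, which the
-- library lacks; we quantify over an arbitrary totally ordered
-- commutative ring (ℝ is one instance).

record OrderedCommRing : Set₁ where
  infixl 6 _+_
  infixl 7 _*_
  infix 4 _≤_
  field
    Carrier : Set
    _+_ _*_ : Carrier → Carrier → Carrier
    -_ : Carrier → Carrier
    0# 1# : Carrier
    _≤_ : Carrier → Carrier → Set
    isCommutativeRing : IsCommutativeRing _≡_ _+_ _*_ -_ 0# 1#
    isTotalOrder : IsTotalOrder _≡_ _≤_
    +-mono-≤ : ∀ {x y} z → x ≤ y → x + z ≤ y + z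
    *-nonneg : ∀ {x y} → 0# ≤ x → 0# ≤ y → 0# ≤ x * y
    0≤1 : 0# ≤ 1#
    0≢1 : ¬ (0# ≡ 1#)

  2# : Carrier
  2# = 1# + 1#

  fromℕ : ℕ → Carrier
  fromℕ zero = 0#
  fromℕ (suc n) = 1# + fromℕ n

fin : {E : Set} → List E → Pred E 0ℓ
fin xs = λ z → z L.∈ xs

module _ (R : OrderedCommRing) where
  open OrderedCommRing R

  record IsPolymatroid {E : Set} (f : Pred E 0ℓ → Carrier) : Set₁ where
    field
      f-∅ : f ∅ ≡ 0#
      monotone : ∀ (A B : Pred E 0ℓ) → A ⊆ B → f A ≤ f B
      submodular : ∀ (A B : Pred E 0ℓ) → f (A ∪ B) + f (A ∩ B) ≤ f A + f B
      -- finite type: f(A) = sup { f(F) | F ⊆ A finite }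
      -- (the upper-bound half follows from monotonicity)
      finiteType : ∀ (A : Pred E 0ℓ) (u : Carrier) →
                   (∀ (F : List E) → fin F ⊆ A → f (fin F) ≤ u) → f A ≤ u

  cl : {E : Set} → (Pred E 0ℓ → Carrier) → Pred E 0ℓ → Pred E 0ℓ
  cl f A x = f (A ∪ fin (x ∷ [])) ≡ f A

data Label (r : ℕ) (S : Set) : Set where
  bL : Fin r → Label r S
  sL : S → (i j : Fin r) → i < j → Label r S

-- s_{i,j} for arbitrary distinct i , j, with the convention
-- s_{j,i} := (s⁻¹)_{i,j} for i < j.
sLbl : {r : ℕ} {S : Set} → (S → S) → S → (i j : Fin r) → i ≢ j → Label r S
sLbl inv s i j i≢j with <-cmp i j
... | tri< i<j _ _ = sL s i j i<j
... | tri≈ _ i≡j _ = ⊥-elim (i≢j i≡j)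
... | tri> _ _ j<i = sL (inv s) j i j<i

-- E is a type with an injective labelling ι : E → Label r S, i.e.
-- B ⊆ E ⊆ B ⊔ ⨆_{i<j} S_{i,j}.  (A coherent PDG additionally has ι
-- surjective and satisfies axiom (6); those are not required here.)

record PossiblyIncoherentPDG (R : OrderedCommRing) (r : ℕ) : Set₁ where
  open OrderedCommRing R
  field
    S : Set
    inv : S → S
    inv-involutive : ∀ s → inv (inv s) ≡ s
    e : S
    inv-e : inv e ≡ e
    E : Set
    ι : E → Label r S
    ι-injective : ∀ x y → ι x ≡ ι y → x ≡ y
    f : Pred E 0ℓ → Carrier
    isPolymatroid : IsPolymatroid R f
    b : Fin r → E
    ι-b : ∀ i → ι (b i) ≡ bL i
    B-free : ∀ (T : Subset r) →
             f (λ x → ∃ λ i → i ∈ T × x ≡ b i) ≡ fromℕ ∣ T ∣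
    s-in-cl : ∀ (x : E) (s : S) (i j : Fin r) (p : i ≢ j) →
              ι x ≡ sLbl inv s i j p → cl R f (fin (b i ∷ b j ∷ [])) x
    s-rank1 : ∀ (x : E) (s : S) (i j : Fin r) (p : i ≢ j) →
              ι x ≡ sLbl inv s i j p → f (fin (x ∷ [])) ≡ 1#
    s-rank2 : ∀ (x : E) (s : S) (i j : Fin r) (p : i ≢ j) →
              ι x ≡ sLbl inv s i j p → f (fin (b i ∷ x ∷ [])) ≡ 2#

{-# OPTIONS --safe #-}
module Submission where

-- An element x = s_{i,j} has rank one and lies in cl(b_i, b_j); by exchange, b_j lies in cl(b_i, x)
-- and b_i in cl(b_j, x).  Hence f(x, y) ≤ f(x) + f(y) = 2, and for the lower bound one starts from
-- the independent set of all basis elements involved, adjoins x and y, deletes the basis elements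
-- that have become spanned (closure is monotone), and finally removes the remaining basis elements
-- one at a time, each of which lowers the rank by at most one.

open import Defs
open import Data.Nat using (ℕ)
open import Data.Fin using (Fin)
open import Data.List using ([]; _∷_)
open import Data.Product using (Σ; _×_)
open import Data.Sum using (_⊎_)
open import Relation.Binary.PropositionalEquality using (_≡_; _≢_)

open import Level using (0ℓ)
open import Function using (_∘_)
open import Algebra.Structures using (IsCommutativeRing)
open import Data.Fin using (_<_; _≟_)
open import Data.Fin.Properties using (<-cmp; <-asym; <-irrelevant; <⇒≢)
import Data.Fin.Subset as Subset
open import Data.List using (List; map; length)
open import Data.List.Membership.Propositional using (_∈_)
open import Data.List.Membership.Propositional.Properties using (∈-map⁺; ∈-map⁻)
open import Data.List.Relation.Binary.Subset.Propositional using () renaming (_⊆_ to _⊆ₗ_)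
open import Data.List.Relation.Binary.Subset.Propositional.Properties using (xs⊆xs++ys; ∈-∷⁺ʳ)
open import Data.List.Relation.Unary.Any using (here; there)
import Data.List.Relation.Unary.All as All
open import Data.List.Relation.Unary.Unique.Propositional using (Unique; []; _∷_)
open import Data.Product using (_,_; ∃)
open import Data.Sum using (inj₁; inj₂)
open import Relation.Binary.Bundles using (Poset)
open import Relation.Binary.Definitions using (tri<; tri≈; tri>)
open import Relation.Binary.PropositionalEquality
  using (refl; sym; trans; cong; cong₂; subst; subst₂; ≢-sym; module ≡-Reasoning)
import Relation.Binary.Reasoning.PartialOrder as PosetReasoning
open import Relation.Binary.Structures using (IsTotalOrder)
open import Relation.Nullary using (¬_; yes; no; contradiction)
open import Relation.Nullary.Decidable using (_×-dec_)
open import Relation.Unary using (Pred; _⊆_; _∪_; _∩_; ∅; _≐_)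

module FinSubset where
  open import Data.Nat using (suc)
  open import Data.Fin using (zero; suc)
  open import Data.Fin.Subset using (Subset; ⊥; ⁅_⁆; ∣_∣; inside; outside)
    renaming (_∪_ to _∪ₛ_; _∈_ to _∈ₛ_; _∉_ to _∉ₛ_)
  open import Data.Fin.Subset.Properties using (x∈p∪q⁺; x∈p∪q⁻; x∈⁅x⁆; x∈⁅y⁆⇒x≡y; ∉⊥; ∣⊥∣≡0; ∪-identityˡ)
  open import Data.Vec using () renaming (_∷_ to _∷ᵥ_; here to hereᵥ; there to thereᵥ)

  fromList : ∀ {n} → List (Fin n) → Subset n
  fromList []       = ⊥
  fromList (i ∷ is) = ⁅ i ⁆ ∪ₛ fromList is

  ∈-fromList⁺ : ∀ {n} {i : Fin n} {is} → i ∈ is → i ∈ₛ fromList is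
  ∈-fromList⁺ {is = j ∷ _}  (here refl)  = x∈p∪q⁺ (inj₁ (x∈⁅x⁆ j))
  ∈-fromList⁺ {is = j ∷ _}  (there i∈is) = x∈p∪q⁺ {p = ⁅ j ⁆} (inj₂ (∈-fromList⁺ i∈is))

  ∈-fromList⁻ : ∀ {n} {i : Fin n} is → i ∈ₛ fromList is → i ∈ is
  ∈-fromList⁻ []       i∈⊥ = contradiction i∈⊥ ∉⊥
  ∈-fromList⁻ (j ∷ is) i∈  with x∈p∪q⁻ ⁅ j ⁆ (fromList is) i∈
  ... | inj₁ i∈⁅j⁆ = here (x∈⁅y⁆⇒x≡y j i∈⁅j⁆)
  ... | inj₂ i∈is  = there (∈-fromList⁻ is i∈is)

  x∉p⇒∣⁅x⁆∪p∣≡1+∣p∣ : ∀ {n} {x : Fin n} {p : Subset n} → x ∉ₛ p → ∣ ⁅ x ⁆ ∪ₛ p ∣ ≡ suc ∣ p ∣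
  x∉p⇒∣⁅x⁆∪p∣≡1+∣p∣ {x = zero}  {outside ∷ᵥ p} _   = cong (λ q → suc ∣ q ∣) (∪-identityˡ p)
  x∉p⇒∣⁅x⁆∪p∣≡1+∣p∣ {x = zero}  {inside  ∷ᵥ p} x∉p = contradiction hereᵥ x∉p
  x∉p⇒∣⁅x⁆∪p∣≡1+∣p∣ {x = suc x} {outside ∷ᵥ p} x∉p = x∉p⇒∣⁅x⁆∪p∣≡1+∣p∣ (x∉p ∘ thereᵥ)
  x∉p⇒∣⁅x⁆∪p∣≡1+∣p∣ {x = suc x} {inside  ∷ᵥ p} x∉p = cong suc (x∉p⇒∣⁅x⁆∪p∣≡1+∣p∣ (x∉p ∘ thereᵥ))

  ∣fromList∣ : ∀ {n} {is : List (Fin n)} → Unique is → ∣ fromList is ∣ ≡ length is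
  ∣fromList∣ {n} []                 = ∣⊥∣≡0 n
  ∣fromList∣ {is = i ∷ is} (i∉is ∷ u) =
    trans (x∉p⇒∣⁅x⁆∪p∣≡1+∣p∣ (λ i∈ → All.lookup i∉is (∈-fromList⁻ is i∈) refl)) (cong suc (∣fromList∣ u))

module OrderedCommRingProperties (R : OrderedCommRing) where
  open OrderedCommRing R public hiding (+-mono-≤)
  open IsCommutativeRing isCommutativeRing public using (+-comm; +-identityʳ)
  open IsCommutativeRing isCommutativeRing using (+-assoc; +-identityˡ; -‿inverseˡ)
  open IsTotalOrder isTotalOrder public using ()
    renaming (isPartialOrder to ≤-isPartialOrder; reflexive to ≤-reflexive; trans to ≤-trans; antisym to ≤-antisym)

  ≤-poset : Poset _ _ _
  ≤-poset = record { isPartialOrder = ≤-isPartialOrder }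

  module ≤-Reasoning = PosetReasoning ≤-poset

  +-monoˡ-≤ : ∀ z {x y} → x ≤ y → x + z ≤ y + z
  +-monoˡ-≤ z = OrderedCommRing.+-mono-≤ R z

  +-monoʳ-≤ : ∀ z {x y} → x ≤ y → z + x ≤ z + y
  +-monoʳ-≤ z {x} {y} x≤y = subst₂ _≤_ (+-comm x z) (+-comm y z) (+-monoˡ-≤ z x≤y)

  +-mono-≤ : ∀ {x y u v} → x ≤ y → u ≤ v → x + u ≤ y + v
  +-mono-≤ {y = y} {u} x≤y u≤v = ≤-trans (+-monoˡ-≤ u x≤y) (+-monoʳ-≤ y u≤v)

  -z+[z+x]≡x : ∀ z x → - z + (z + x) ≡ x
  -z+[z+x]≡x z x = begin
    - z + (z + x)  ≡⟨ sym (+-assoc (- z) z x) ⟩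
    (- z + z) + x  ≡⟨ cong (_+ x) (-‿inverseˡ z) ⟩
    0# + x         ≡⟨ +-identityˡ x ⟩
    x              ∎
    where open ≡-Reasoning

  +-cancelˡ-≤ : ∀ z {x y} → z + x ≤ z + y → x ≤ y
  +-cancelˡ-≤ z {x} {y} z+x≤z+y =
    subst₂ _≤_ (-z+[z+x]≡x z x) (-z+[z+x]≡x z y) (+-monoʳ-≤ (- z) z+x≤z+y)

  fromℕ-2 : fromℕ 2 ≡ 2#
  fromℕ-2 = cong (1# +_) (+-identityʳ 1#)

pair⊆ : ∀ {A : Set} {u v : A} {xs} → u ∈ xs → v ∈ xs → u ∷ v ∷ [] ⊆ₗ xs
pair⊆ u∈xs v∈xs = ∈-∷⁺ʳ u∈xs (∈-∷⁺ʳ v∈xs (λ ()))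

module PolymatroidProperties {R : OrderedCommRing} {E : Set} {f : Pred E 0ℓ → OrderedCommRing.Carrier R}
                             (isPolymatroid : IsPolymatroid R f) where
  open OrderedCommRingProperties R
  open IsPolymatroid isPolymatroid
  open ≤-Reasoning

  f-resp-≐ : ∀ {A C} → A ≐ C → f A ≡ f C
  f-resp-≐ (A⊆C , C⊆A) = ≤-antisym (monotone _ _ A⊆C) (monotone _ _ C⊆A)

  f-nonneg : ∀ A → 0# ≤ f A
  f-nonneg A = begin
    0#   ≡⟨ sym f-∅ ⟩
    f ∅  ≤⟨ monotone ∅ A (λ ()) ⟩
    f A  ∎

  f-subadditive : ∀ A C → f (A ∪ C) ≤ f A + f C
  f-subadditive A C = begin
    f (A ∪ C)               ≡⟨ sym (+-identityʳ _) ⟩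
    f (A ∪ C) + 0#          ≤⟨ +-monoʳ-≤ (f (A ∪ C)) (f-nonneg (A ∩ C)) ⟩
    f (A ∪ C) + f (A ∩ C)   ≤⟨ submodular A C ⟩
    f A + f C               ∎

  F : List E → Carrier
  F xs = f (fin xs)

  F-mono : ∀ {xs ys} → xs ⊆ₗ ys → F xs ≤ F ys
  F-mono xs⊆ys = monotone _ _ xs⊆ys

  F-swap : ∀ u v → F (u ∷ v ∷ []) ≡ F (v ∷ u ∷ [])
  F-swap u v = ≤-antisym (F-mono swap) (F-mono swap)
    where
    swap : ∀ {x y} → x ∷ y ∷ [] ⊆ₗ y ∷ x ∷ []
    swap (here refl)         = there (here refl)
    swap (there (here refl)) = here refl

  F-∷-≤ : ∀ z xs → F (z ∷ xs) ≤ F (z ∷ []) + F xs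
  F-∷-≤ z xs = ≤-trans (monotone _ _ split) (f-subadditive (fin (z ∷ [])) (fin xs))
    where
    split : fin (z ∷ xs) ⊆ fin (z ∷ []) ∪ fin xs
    split (here x≡z)   = inj₁ (here x≡z)
    split (there x∈xs) = inj₂ x∈xs

  F-peel : ∀ {z xs a} → F (z ∷ []) ≤ 1# → 1# + a ≤ F (z ∷ xs) → a ≤ F xs
  F-peel {z} {xs} {a} z≤1 1+a≤ = +-cancelˡ-≤ 1# (begin
    1# + a              ≤⟨ 1+a≤ ⟩
    F (z ∷ xs)          ≤⟨ F-∷-≤ z xs ⟩
    F (z ∷ []) + F xs   ≤⟨ +-monoˡ-≤ (F xs) z≤1 ⟩
    1# + F xs           ∎)

  F-pair≤2 : ∀ {u v} → F (u ∷ []) ≤ 1# → F (v ∷ []) ≤ 1# → F (u ∷ v ∷ []) ≤ 2#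
  F-pair≤2 {u} {v} u≤1 v≤1 = ≤-trans (F-∷-≤ u (v ∷ [])) (+-mono-≤ u≤1 v≤1)

  F-pair≡2 : ∀ {u v} → F (u ∷ []) ≤ 1# → F (v ∷ []) ≤ 1# → fromℕ 2 ≤ F (u ∷ v ∷ []) →
             F (u ∷ v ∷ []) ≡ 2#
  F-pair≡2 {u} {v} u≤1 v≤1 2≤uv =
    ≤-antisym (F-pair≤2 u≤1 v≤1) (subst (_≤ F (u ∷ v ∷ [])) fromℕ-2 2≤uv)

  -- The other inequality, F A ≤ F (z ∷ A), is monotonicity.
  _∈cl_ : E → List E → Set
  z ∈cl A = F (z ∷ A) ≤ F A

  cl⇒∈cl : ∀ {z A} → cl R f (fin A) z → z ∈cl A
  cl⇒∈cl {z} {A} z∈clA = ≤-trans (monotone _ _ z∷A⊆) (≤-reflexive z∈clA)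
    where
    z∷A⊆ : fin (z ∷ A) ⊆ fin A ∪ fin (z ∷ [])
    z∷A⊆ (here x≡z)   = inj₂ (here x≡z)
    z∷A⊆ (there x∈A) = inj₁ x∈A

  ∈cl-mono : ∀ {z A X} → z ∈cl A → A ⊆ₗ X → z ∈cl X
  ∈cl-mono {z} {A} {X} z∈clA A⊆X = +-cancelˡ-≤ (F A) (begin
    F A + F (z ∷ X)                                      ≡⟨ +-comm _ _ ⟩
    F (z ∷ X) + F A                                      ≤⟨ +-mono-≤ (monotone _ _ z∷X⊆) (monotone _ _ A⊆) ⟩
    f (fin (z ∷ A) ∪ fin X) + f (fin (z ∷ A) ∩ fin X)    ≤⟨ submodular _ _ ⟩
    F (z ∷ A) + F X                                      ≤⟨ +-monoˡ-≤ (F X) z∈clA ⟩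
    F A + F X                                            ∎)
    where
    z∷X⊆ : fin (z ∷ X) ⊆ fin (z ∷ A) ∪ fin X
    z∷X⊆ (here x≡z)   = inj₁ (here x≡z)
    z∷X⊆ (there x∈X) = inj₂ x∈X
    A⊆ : fin A ⊆ fin (z ∷ A) ∩ fin X
    A⊆ x∈A = there x∈A , A⊆X x∈A

  ∈cl-exchange : ∀ {z u v} → z ∈cl (u ∷ v ∷ []) → F (u ∷ v ∷ []) ≤ F (u ∷ z ∷ []) → v ∈cl (u ∷ z ∷ [])
  ∈cl-exchange {z} {u} {v} z∈cl uv≤uz = begin
    F (v ∷ u ∷ z ∷ [])  ≤⟨ F-mono rotate ⟩
    F (z ∷ u ∷ v ∷ [])  ≤⟨ z∈cl ⟩
    F (u ∷ v ∷ [])      ≤⟨ uv≤uz ⟩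
    F (u ∷ z ∷ [])      ∎
    where
    rotate : v ∷ u ∷ z ∷ [] ⊆ₗ z ∷ u ∷ v ∷ []
    rotate (here refl)                 = there (there (here refl))
    rotate (there (here refl))         = there (here refl)
    rotate (there (there (here refl))) = here refl

module _ {r : ℕ} {S : Set} (inv : S → S) {s : S} {i j : Fin r} (i<j : i < j) where

  sLbl-< : (i≢j : i ≢ j) → sLbl inv s i j i≢j ≡ sL s i j i<j
  sLbl-< i≢j with <-cmp i j
  ... | tri< i<j′ _ _ = cong (sL s i j) (<-irrelevant i<j′ i<j)
  ... | tri≈ i≮j _ _ = contradiction i<j i≮j
  ... | tri> i≮j _ _ = contradiction i<j i≮j

  sLbl-> : inv (inv s) ≡ s → (j≢i : j ≢ i) → sLbl inv (inv s) j i j≢i ≡ sL s i j i<j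
  sLbl-> inv²s≡s j≢i with <-cmp j i
  ... | tri< j<i _ _  = contradiction j<i (<-asym i<j)
  ... | tri≈ _ j≡i _  = contradiction j≡i j≢i
  ... | tri> _ _ i<j′ = cong₂ (λ t i<j″ → sL t i j i<j″) inv²s≡s (<-irrelevant i<j′ i<j)

module PDGProperties {R : OrderedCommRing} {r : ℕ} (P : PossiblyIncoherentPDG R r) where
  open OrderedCommRingProperties R
  open PossiblyIncoherentPDG P
  open PolymatroidProperties isPolymatroid
  open FinSubset using (fromList; ∈-fromList⁺; ∈-fromList⁻; ∣fromList∣)
  open ≤-Reasoning

  basisSet : Subset.Subset r → Pred E 0ℓ
  basisSet T x = ∃ λ i → i Subset.∈ T × x ≡ b i

  F-basis : ∀ {is} → Unique is → F (map b is) ≡ fromℕ (length is)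
  F-basis {is} unique = begin-equality
    F (map b is)                    ≡⟨ f-resp-≐ (fin⊆basisSet , basisSet⊆fin) ⟩
    f (basisSet (fromList is))      ≡⟨ B-free (fromList is) ⟩
    fromℕ (Subset.∣ fromList is ∣)  ≡⟨ cong fromℕ (∣fromList∣ unique) ⟩
    fromℕ (length is)               ∎
    where
    fin⊆basisSet : fin (map b is) ⊆ basisSet (fromList is)
    fin⊆basisSet x∈ with ∈-map⁻ b x∈
    ... | i , i∈is , x≡bi = i , ∈-fromList⁺ i∈is , x≡bi
    basisSet⊆fin : basisSet (fromList is) ⊆ fin (map b is)
    basisSet⊆fin (i , i∈ , refl) = ∈-map⁺ b (∈-fromList⁻ is i∈)

  b-rank-one : ∀ i → F (b i ∷ []) ≤ 1#
  b-rank-one i = ≤-reflexive (trans (F-basis (All.[] ∷ [])) (+-identityʳ 1#))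

  record OnLine (x : E) (i j : Fin r) : Set where
    field
      ends-distinct : i ≢ j
      rank-one      : F (x ∷ []) ≤ 1#
      rank-twoˡ     : F (b i ∷ x ∷ []) ≡ 2#
      rank-twoʳ     : F (b j ∷ x ∷ []) ≡ 2#
      spanned       : x ∈cl (b i ∷ b j ∷ [])

  open OnLine

  OnLine-sym : ∀ {x i j} → OnLine x i j → OnLine x j i
  OnLine-sym L = record
    { ends-distinct = ≢-sym (ends-distinct L)
    ; rank-one      = rank-one L
    ; rank-twoˡ     = rank-twoʳ L
    ; rank-twoʳ     = rank-twoˡ L
    ; spanned       = ∈cl-mono (spanned L) (pair⊆ (there (here refl)) (here refl))
    }

  exchange : ∀ {x i j} → OnLine x i j → b j ∈cl (b i ∷ x ∷ [])
  exchange {x} {i} {j} L = ∈cl-exchange (spanned L) (begin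
    F (b i ∷ b j ∷ [])  ≤⟨ F-pair≤2 (b-rank-one i) (b-rank-one j) ⟩
    2#                  ≡⟨ sym (rank-twoˡ L) ⟩
    F (b i ∷ x ∷ [])    ∎)

  sL⇒OnLine : ∀ {x s i j} (i<j : i < j) → ι x ≡ sL s i j i<j → OnLine x i j
  sL⇒OnLine {x} {s} {i} {j} i<j ιx≡sᵢⱼ = record
    { ends-distinct = i≢j
    ; rank-one      = ≤-reflexive (s-rank1 x s i j i≢j ιx≡sLblᵢⱼ)
    ; rank-twoˡ     = s-rank2 x s i j i≢j ιx≡sLblᵢⱼ
    ; rank-twoʳ     = s-rank2 x (inv s) j i (≢-sym i≢j) ιx≡sLblⱼᵢ
    ; spanned       = cl⇒∈cl (s-in-cl x s i j i≢j ιx≡sLblᵢⱼ)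
    }
    where
    i≢j : i ≢ j
    i≢j = <⇒≢ i<j
    ιx≡sLblᵢⱼ : ι x ≡ sLbl inv s i j i≢j
    ιx≡sLblᵢⱼ = trans ιx≡sᵢⱼ (sym (sLbl-< inv i<j i≢j))
    ιx≡sLblⱼᵢ : ι x ≡ sLbl inv (inv s) j i (≢-sym i≢j)
    ιx≡sLblⱼᵢ = trans ιx≡sᵢⱼ (sym (sLbl-> inv i<j (inv-involutive s) (≢-sym i≢j)))

  off-line-rank : ∀ {x i j k} → OnLine x i j → k ≢ i → k ≢ j → fromℕ 2 ≤ F (b k ∷ x ∷ [])
  off-line-rank {x} {i} {j} {k} L k≢i k≢j = F-peel (b-rank-one i) (begin
    fromℕ 3                       ≡⟨ sym (F-basis unique) ⟩
    F (b j ∷ b i ∷ b k ∷ [])      ≤⟨ F-mono (xs⊆xs++ys _ (x ∷ [])) ⟩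
    F (b j ∷ b i ∷ b k ∷ x ∷ [])  ≤⟨ ∈cl-mono (exchange L) (pair⊆ (here refl) (there (there (here refl)))) ⟩
    F (b i ∷ b k ∷ x ∷ [])        ∎)
    where
    unique : Unique (j ∷ i ∷ k ∷ [])
    unique = (≢-sym (ends-distinct L) All.∷ ≢-sym k≢j All.∷ All.[])
           ∷ (≢-sym k≢i All.∷ All.[])
           ∷ All.[] ∷ []

  concurrent-lines-rank : ∀ {x y c a a′} → OnLine x c a → OnLine y c a′ → a ≢ a′ →
                          fromℕ 2 ≤ F (x ∷ y ∷ [])
  concurrent-lines-rank {x} {y} {c} {a} {a′} Lx Ly a≢a′ = F-peel (b-rank-one c) (begin
    fromℕ 3                              ≡⟨ sym (F-basis unique) ⟩
    F (b a ∷ b a′ ∷ b c ∷ [])            ≤⟨ F-mono (xs⊆xs++ys _ (x ∷ y ∷ [])) ⟩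
    F (b a ∷ b a′ ∷ b c ∷ x ∷ y ∷ [])    ≤⟨ ∈cl-mono (exchange Lx)
                                              (pair⊆ (there (here refl)) (there (there (here refl)))) ⟩
    F (b a′ ∷ b c ∷ x ∷ y ∷ [])          ≤⟨ ∈cl-mono (exchange Ly) (pair⊆ (here refl) (there (there (here refl)))) ⟩
    F (b c ∷ x ∷ y ∷ [])                 ∎)
    where
    unique : Unique (a ∷ a′ ∷ c ∷ [])
    unique = (a≢a′ All.∷ ≢-sym (ends-distinct Lx) All.∷ All.[])
           ∷ (≢-sym (ends-distinct Ly) All.∷ All.[])
           ∷ All.[] ∷ []

  skew-lines-rank : ∀ {x y a c a′ c′} → OnLine x a c → OnLine y a′ c′ →
                    a ≢ a′ → a ≢ c′ → c ≢ a′ → c ≢ c′ → fromℕ 2 ≤ F (x ∷ y ∷ [])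
  skew-lines-rank {x} {y} {a} {c} {a′} {c′} Lx Ly a≢a′ a≢c′ c≢a′ c≢c′ =
    F-peel (b-rank-one a′) (F-peel (b-rank-one a) (begin
      fromℕ 4                                   ≡⟨ sym (F-basis unique) ⟩
      F (b c′ ∷ b c ∷ b a ∷ b a′ ∷ [])          ≤⟨ F-mono (xs⊆xs++ys _ (x ∷ y ∷ [])) ⟩
      F (b c′ ∷ b c ∷ b a ∷ b a′ ∷ x ∷ y ∷ [])  ≤⟨ ∈cl-mono (exchange Ly) (pair⊆ (there (there (here refl)))
                                                                                (there (there (there (there (here refl)))))) ⟩
      F (b c ∷ b a ∷ b a′ ∷ x ∷ y ∷ [])         ≤⟨ ∈cl-mono (exchange Lx) (pair⊆ (here refl) (there (there (here refl)))) ⟩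
      F (b a ∷ b a′ ∷ x ∷ y ∷ [])               ∎))
    where
    unique : Unique (c′ ∷ c ∷ a ∷ a′ ∷ [])
    unique = (≢-sym c≢c′ All.∷ ≢-sym a≢c′ All.∷ ≢-sym (ends-distinct Ly) All.∷ All.[])
           ∷ (≢-sym (ends-distinct Lx) All.∷ c≢a′ All.∷ All.[])
           ∷ (a≢a′ All.∷ All.[])
           ∷ All.[] ∷ []

  distinct-lines-rank : ∀ {x y i j k l} → OnLine x i j → OnLine y k l →
                        ¬ (i ≡ k × j ≡ l) → ¬ (i ≡ l × j ≡ k) → fromℕ 2 ≤ F (x ∷ y ∷ [])
  distinct-lines-rank {i = i} {j} {k} {l} Lx Ly ¬same ¬crossed with i ≟ k | i ≟ l | j ≟ k | j ≟ l
  ... | yes refl | _        | _        | yes refl = contradiction (refl , refl) ¬same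
  ... | yes refl | _        | _        | no j≢l   = concurrent-lines-rank Lx Ly j≢l
  ... | no _     | yes refl | yes refl | _        = contradiction (refl , refl) ¬crossed
  ... | no _     | yes refl | no j≢k   | _        = concurrent-lines-rank Lx (OnLine-sym Ly) j≢k
  ... | no _     | no i≢l   | yes refl | _        = concurrent-lines-rank (OnLine-sym Lx) Ly i≢l
  ... | no i≢k   | no _     | no _     | yes refl = concurrent-lines-rank (OnLine-sym Lx) (OnLine-sym Ly) i≢k
  ... | no i≢k   | no i≢l   | no j≢k   | no j≢l   = skew-lines-rank Lx Ly i≢k i≢l j≢k j≢l

  basis-line-rank : ∀ {x i j} → OnLine x i j → ∀ k → F (b k ∷ x ∷ []) ≡ 2#
  basis-line-rank {i = i} {j} L k with k ≟ i | k ≟ j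
  ... | yes refl | _        = rank-twoˡ L
  ... | no _     | yes refl = rank-twoʳ L
  ... | no k≢i   | no k≢j   = F-pair≡2 (b-rank-one k) (rank-one L) (off-line-rank L k≢i k≢j)

  basis-pair-rank : ∀ {i j} → i ≢ j → F (b i ∷ b j ∷ []) ≡ 2#
  basis-pair-rank {i} {j} i≢j = trans (F-basis ((i≢j All.∷ All.[]) ∷ All.[] ∷ [])) fromℕ-2

  data Position : E → Set where
    basis : ∀ i → Position (b i)
    line  : ∀ {x} s {i j} (i<j : i < j) → ι x ≡ sL s i j i<j → Position x

  position : ∀ x → Position x
  position x with ι x in ιx≡
  ... | bL i         = subst Position (sym (ι-injective x (b i) (trans ιx≡ (sym (ι-b i))))) (basis i)
  ... | sL s i j i<j = line s i<j ιx≡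

  OnSameLine : E → E → Set
  OnSameLine x y = Σ S λ s → Σ S λ s′ → Σ (Fin r) λ i → Σ (Fin r) λ j → Σ (i ≢ j) λ i≢j →
                   ι x ≡ sLbl inv s i j i≢j × ι y ≡ sLbl inv s′ i j i≢j

  rank-two-or-same-line : ∀ {x y} → x ≢ y → Position x → Position y → F (x ∷ y ∷ []) ≡ 2# ⊎ OnSameLine x y
  rank-two-or-same-line x≢y (basis i) (basis j) with i ≟ j
  ... | yes refl = contradiction refl x≢y
  ... | no i≢j   = inj₁ (basis-pair-rank i≢j)
  rank-two-or-same-line _ (basis k) (line _ i<j ιy) = inj₁ (basis-line-rank (sL⇒OnLine i<j ιy) k)
  rank-two-or-same-line {x} {y} _ (line _ i<j ιx) (basis k) =
    inj₁ (trans (F-swap x y) (basis-line-rank (sL⇒OnLine i<j ιx) k))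
  rank-two-or-same-line {x} {y} _ (line s {i} {j} i<j ιx) (line s′ {k} {l} k<l ιy) with (i ≟ k) ×-dec (j ≟ l)
  ... | yes (refl , refl) = inj₂ (s , s′ , i , j , i≢j , trans ιx (sym (sLbl-< inv i<j i≢j))
                                                       , trans ιy (sym (sLbl-< inv k<l i≢j)))
    where
    i≢j : i ≢ j
    i≢j = <⇒≢ i<j
  ... | no ¬same = inj₁ (F-pair≡2 (rank-one Lx) (rank-one Ly) (distinct-lines-rank Lx Ly ¬same ¬crossed))
    where
    Lx : OnLine x i j
    Lx = sL⇒OnLine i<j ιx
    Ly : OnLine y k l
    Ly = sL⇒OnLine k<l ιy
    ¬crossed : ¬ (i ≡ l × j ≡ k)
    ¬crossed (refl , refl) = <-asym i<j k<l

corollary4p7 : (R : OrderedCommRing) (r : ℕ) (P : PossiblyIncoherentPDG R r) →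
    (x y : PossiblyIncoherentPDG.E P) → x ≢ y →
    PossiblyIncoherentPDG.f P (fin (x ∷ y ∷ [])) ≡ OrderedCommRing.2# R
    ⊎ Σ (PossiblyIncoherentPDG.S P) (λ s → Σ (PossiblyIncoherentPDG.S P) (λ s′ →
        Σ (Fin r) (λ i → Σ (Fin r) (λ j → Σ (i ≢ j) (λ p →
          PossiblyIncoherentPDG.ι P x ≡ sLbl (PossiblyIncoherentPDG.inv P) s i j p
          × PossiblyIncoherentPDG.ι P y ≡ sLbl (PossiblyIncoherentPDG.inv P) s′ i j p)))))
corollary4p7 R r P x y x≢y = rank-two-or-same-line x≢y (position x) (position y)
  where open PDGProperties P
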